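{- For every integer $m\ge 1$ and all integers $1\le k\le n$: (1) $g_m(n,k)$ equals the number of Dyck paths of semilength $n-1$ whose hills are each colored with one of $m$ colors, such that exactly $k-1$ hills have color $m$; (2) $f_m(n)$ equals the number of Dyck paths of semilength $n-1$ whose hills are each colored with one of $m$ colors.
   Context: A Dyck path of semilength $r$ is a lattice path from $(0,0)$ to $(2r,0)$ with steps $(1,1)$ and $(1,-1)$ never going below the $x$-axis. A hill is an up step starting on the $x$-axis immediately followed by a down step returning to the $x$-axis. The Fine numbers are indexed so that $\mathbb F_n$ ($n\ge1$) is the number of Dyck paths of semilength $n-1$ with no hills; thus $\mathbb F_1=1,\mathbb F_2=0,\mathbb F_3=1,\dots$. Define $f_0(n)=\mathbb F_n$ for $n\ge1$, and for $m\ge1$ and $1\le k\le n$, $g_m(n,k)=\sum_{i_1+\cdots+i_k=n} f_{m-1}(i_1)\cdots f_{m-1}(i_k)$ (sum over ordered $k$-tuples of positive integers), and $f_m(n)=\sum_{k=1}^n g_m(n,k)$ (so $f_m$ is the invert transform of $f_{m-1}$). -}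

module Defs where

open import Data.Nat using (ℕ; zero; suc; _+_; _*_; _∸_; _≡ᵇ_)
open import Data.Bool using (Bool; true; false; _∧_; if_then_else_)
open import Data.List using (List; []; _∷_; map; concatMap; filter; length; upTo)
open import Data.Nat.ListAction using (sum; product)
open import Data.Product using (_×_; _,_)
open import Relation.Nullary.Decidable using (Dec; yes; no)
open import Data.Bool.Properties using (T?)

data Step : Set where
  U D : Step

allWords : ℕ → List (List Step)
allWords zero    = [] ∷ []
allWords (suc l) = concatMap (λ w → (U ∷ w) ∷ (D ∷ w) ∷ []) (allWords l)

validFrom : ℕ → List Step → Bool
validFrom zero    []          = true
validFrom (suc h) []          = false
validFrom h       (U ∷ w)     = validFrom (suc h) w
validFrom zero    (D ∷ w)     = false
validFrom (suc h) (D ∷ w)     = validFrom h w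

isDyck : List Step → Bool
isDyck = validFrom 0

dyckPaths : ℕ → List (List Step)
dyckPaths r = filter (λ w → T? (isDyck w)) (allWords (r + r))

hillsFrom : ℕ → List Step → ℕ
hillsFrom zero    (U ∷ D ∷ w) = suc (hillsFrom zero w)
hillsFrom h       (U ∷ w)     = hillsFrom (suc h) w
hillsFrom h       (D ∷ w)     = hillsFrom (h ∸ 1) w
hillsFrom h       []          = 0

hills : List Step → ℕ
hills = hillsFrom 0

-- Fine numbers: F n = number of Dyck paths of semilength n-1 with no hills
-- (only meaningful for n ≥ 1).

Fine : ℕ → ℕ
Fine n = length (filter (λ w → T? (hills w ≡ᵇ 0)) (dyckPaths (n ∸ 1)))

compositions : ℕ → ℕ → List (List ℕ)
compositions zero    zero    = [] ∷ []
compositions (suc n) zero    = []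
compositions n       (suc k) =
  concatMap (λ j → map (suc j ∷_) (compositions (n ∸ suc j) k)) (upTo n)

invertTerm : (ℕ → ℕ) → ℕ → ℕ → ℕ
invertTerm a n k = sum (map (λ c → product (map a c)) (compositions n k))

-- f m n  (f_0 = Fine; f_m = invert transform of f_{m-1})
f : ℕ → ℕ → ℕ
f zero    n = Fine n
f (suc m) n = sum (map (λ j → invertTerm (f m) n (suc j)) (upTo n))

-- g m n k  (only meaningful for m ≥ 1)
g : ℕ → ℕ → ℕ → ℕ
g zero    n k = 0
g (suc m) n k = invertTerm (f m) n k

-- Hill colorings: a coloring of the h hills (in left-to-right order)
-- with colors from {1,…,m} is a list of length h with entries in 1..m.

colorings : ℕ → ℕ → List (List ℕ)
colorings m zero    = [] ∷ []
colorings m (suc h) = concatMap (λ c → map (suc c ∷_) (colorings m h)) (upTo m)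

countOf : ℕ → List ℕ → ℕ
countOf x []       = 0
countOf x (y ∷ ys) = (if x ≡ᵇ y then 1 else 0) + countOf x ys

coloredDyck : ℕ → ℕ → ℕ
coloredDyck m r = sum (map (λ p → length (colorings m (hills p))) (dyckPaths r))

coloredDyckWith : ℕ → ℕ → ℕ → ℕ
coloredDyckWith m r j =
  sum (map (λ p → length (filter (λ c → T? (countOf m c ≡ᵇ j)) (colorings m (hills p))))
           (dyckPaths r))

-- Cutting a Dyck path at its h hills leaves h + 1 hill-free pieces, so if F = Σ Fₙ xⁿ is the
-- Fine series, the paths of semilength n − 1 weighted by ω(number of hills) have generating
-- function H_ω = Σₕ ω(h) F^(h+1), that is H_ω = ω(0) F + F H_ω(·+1).  For ω(h) = mʰ this is
-- F/(1 − mF), and the invert transform sends F/(1 − mF) to F/(1 − (m+1)F), so it is the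
-- generating function of f_m.  The k-th power of F/(1 − (m−1)F), whose coefficients are
-- g_m(·,k), is H_ω for ω(h) = the number of m-colourings of h hills with exactly k − 1 hills of
-- colour m, because that ω satisfies the same kind of recurrence.  All identities are proved in
-- ℕ[[x]] without division: both sides solve X = A + BX with B(0) = 0, whose solution is unique.
-- The hill decomposition itself comes from a first-passage decomposition of walks.

module Submission where

open import Defs
open import Data.Bool using (Bool; true; false; if_then_else_)
open import Data.Empty using (⊥)
open import Data.List using (List; []; _∷_; _++_; [_]; map; concatMap; filter; length; upTo; applyUpTo)
open import Data.List.Properties using (map-++; map-cong; map-∘; map-upTo; upTo-∷ʳ; applyUpTo-∷ʳ)
open import Data.Nat using (ℕ; zero; suc; _+_; _*_; _∸_; _≡ᵇ_; _≤_; _<_; z≤n; s≤s; s≤s⁻¹)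
open import Data.Nat.Induction using (<-rec)
open import Data.Nat.ListAction using (sum; product)
open import Data.Nat.ListAction.Properties using (sum-++)
open import Data.Nat.Properties
open import Algebra.Properties.CommutativeSemigroup +-commutativeSemigroup using (interchange; x∙yz≈xz∙y)
open import Data.Product using (_×_; _,_)
open import Data.Sum using (inj₁; inj₂)
open import Data.Unit using (⊤)
open import Relation.Nullary.Decidable using (T?)
open import Relation.Binary.PropositionalEquality hiding ([_])
open ≡-Reasoning

-- Formal power series over ℕ

Series : Set
Series = ℕ → ℕ

infixl 6 _⊕_
infixl 7 _∗_
infixr 8 _·_

𝟘 𝟙 : Series
𝟘 _ = 0
𝟙 zero    = 1
𝟙 (suc _) = 0

_⊕_ : Series → Series → Series
(a ⊕ b) n = a n + b n

_·_ : ℕ → Series → Series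
(k · a) n = k * a n

tail shift : Series → Series
tail a n = a (suc n)
shift a zero    = 0
shift a (suc n) = a n

_∗_ : Series → Series → Series
(a ∗ b) zero    = a 0 * b 0
(a ∗ b) (suc n) = a 0 * b (suc n) + (tail a ∗ b) n

∗-cong : ∀ {a a′ b b′} → a ≗ a′ → b ≗ b′ → a ∗ b ≗ a′ ∗ b′
∗-cong a≗a′ b≗b′ zero    = cong₂ _*_ (a≗a′ 0) (b≗b′ 0)
∗-cong a≗a′ b≗b′ (suc n) =
  cong₂ _+_ (cong₂ _*_ (a≗a′ 0) (b≗b′ (suc n))) (∗-cong (λ i → a≗a′ (suc i)) b≗b′ n)

∗-congˡ : ∀ {a b b′} → b ≗ b′ → a ∗ b ≗ a ∗ b′
∗-congˡ = ∗-cong (λ _ → refl)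

∗-congʳ : ∀ {a a′ b} → a ≗ a′ → a ∗ b ≗ a′ ∗ b
∗-congʳ a≗a′ = ∗-cong a≗a′ (λ _ → refl)

∗-sucʳ : ∀ a b n → (a ∗ b) (suc n) ≡ (a ∗ tail b) n + a (suc n) * b 0
∗-sucʳ a b zero    = refl
∗-sucʳ a b (suc n) = begin
  a 0 * b (suc (suc n)) + (tail a ∗ b) (suc n)
    ≡⟨ cong (a 0 * b (suc (suc n)) +_) (∗-sucʳ (tail a) b n) ⟩
  a 0 * b (suc (suc n)) + ((tail a ∗ tail b) n + a (suc (suc n)) * b 0)
    ≡⟨ +-assoc (a 0 * b (suc (suc n))) _ _ ⟨
  a 0 * b (suc (suc n)) + (tail a ∗ tail b) n + a (suc (suc n)) * b 0 ∎

∗-comm : ∀ a b → a ∗ b ≗ b ∗ a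
∗-comm a b zero    = *-comm (a 0) (b 0)
∗-comm a b (suc n) = begin
  a 0 * b (suc n) + (tail a ∗ b) n ≡⟨ cong₂ _+_ (*-comm (a 0) _) (∗-comm (tail a) b n) ⟩
  b (suc n) * a 0 + (b ∗ tail a) n ≡⟨ +-comm _ ((b ∗ tail a) n) ⟩
  (b ∗ tail a) n + b (suc n) * a 0 ≡⟨ ∗-sucʳ b a n ⟨
  (b ∗ a) (suc n)                  ∎

∗-zeroˡ : ∀ b → 𝟘 ∗ b ≗ 𝟘
∗-zeroˡ b zero    = refl
∗-zeroˡ b (suc n) = ∗-zeroˡ b n

∗-zeroʳ : ∀ a → a ∗ 𝟘 ≗ 𝟘
∗-zeroʳ a n = trans (∗-comm a 𝟘 n) (∗-zeroˡ a n)

∗-identityˡ : ∀ b → 𝟙 ∗ b ≗ b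
∗-identityˡ b zero    = +-identityʳ (b 0)
∗-identityˡ b (suc n) = trans (cong₂ _+_ (+-identityʳ (b (suc n))) (∗-zeroˡ b n)) (+-identityʳ _)

∗-identityʳ : ∀ a → a ∗ 𝟙 ≗ a
∗-identityʳ a n = trans (∗-comm a 𝟙 n) (∗-identityˡ a n)

∗-distribʳ-⊕ : ∀ a b c → (a ⊕ b) ∗ c ≗ a ∗ c ⊕ b ∗ c
∗-distribʳ-⊕ a b c zero    = *-distribʳ-+ (c 0) (a 0) (b 0)
∗-distribʳ-⊕ a b c (suc n) = trans
  (cong₂ _+_ (*-distribʳ-+ (c (suc n)) (a 0) (b 0)) (∗-distribʳ-⊕ (tail a) (tail b) c n))
  (interchange (a 0 * c (suc n)) (b 0 * c (suc n)) _ _)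

∗-distribˡ-⊕ : ∀ a b c → a ∗ (b ⊕ c) ≗ a ∗ b ⊕ a ∗ c
∗-distribˡ-⊕ a b c n = begin
  (a ∗ (b ⊕ c)) n         ≡⟨ ∗-comm a (b ⊕ c) n ⟩
  ((b ⊕ c) ∗ a) n         ≡⟨ ∗-distribʳ-⊕ b c a n ⟩
  (b ∗ a) n + (c ∗ a) n   ≡⟨ cong₂ _+_ (∗-comm b a n) (∗-comm c a n) ⟩
  (a ∗ b) n + (a ∗ c) n   ∎

∗-scaleˡ : ∀ k a c → (k · a) ∗ c ≗ k · (a ∗ c)
∗-scaleˡ k a c zero    = *-assoc k (a 0) (c 0)
∗-scaleˡ k a c (suc n) = begin
  k * a 0 * c (suc n) + ((k · tail a) ∗ c) n
    ≡⟨ cong₂ _+_ (*-assoc k (a 0) _) (∗-scaleˡ k (tail a) c n) ⟩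
  k * (a 0 * c (suc n)) + k * (tail a ∗ c) n
    ≡⟨ *-distribˡ-+ k (a 0 * c (suc n)) _ ⟨
  k * (a 0 * c (suc n) + (tail a ∗ c) n) ∎

∗-scaleʳ : ∀ k a c → a ∗ (k · c) ≗ k · (a ∗ c)
∗-scaleʳ k a c n = begin
  (a ∗ (k · c)) n  ≡⟨ ∗-comm a (k · c) n ⟩
  ((k · c) ∗ a) n  ≡⟨ ∗-scaleˡ k c a n ⟩
  k * (c ∗ a) n    ≡⟨ cong (k *_) (∗-comm c a n) ⟩
  k * (a ∗ c) n    ∎

tail-∗ : ∀ a b → tail (a ∗ b) ≗ a 0 · tail b ⊕ tail a ∗ b
tail-∗ a b n = refl

∗-assoc : ∀ a b c → (a ∗ b) ∗ c ≗ a ∗ (b ∗ c)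
∗-assoc a b c zero    = *-assoc (a 0) (b 0) (c 0)
∗-assoc a b c (suc n) = begin
  a 0 * b 0 * c (suc n) + (tail (a ∗ b) ∗ c) n
    ≡⟨ cong (a 0 * b 0 * c (suc n) +_) (trans (∗-congʳ (tail-∗ a b) n)
         (∗-distribʳ-⊕ (a 0 · tail b) (tail a ∗ b) c n)) ⟩
  a 0 * b 0 * c (suc n) + (((a 0 · tail b) ∗ c) n + ((tail a ∗ b) ∗ c) n)
    ≡⟨ cong₂ (λ x y → a 0 * b 0 * c (suc n) + (x + y))
         (∗-scaleˡ (a 0) (tail b) c n) (∗-assoc (tail a) b c n) ⟩
  a 0 * b 0 * c (suc n) + (a 0 * (tail b ∗ c) n + (tail a ∗ (b ∗ c)) n)
    ≡⟨ +-assoc (a 0 * b 0 * c (suc n)) _ _ ⟨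
  a 0 * b 0 * c (suc n) + a 0 * (tail b ∗ c) n + (tail a ∗ (b ∗ c)) n
    ≡⟨ cong (_+ (tail a ∗ (b ∗ c)) n) (trans (cong (_+ a 0 * (tail b ∗ c) n) (*-assoc (a 0) (b 0) _))
         (sym (*-distribˡ-+ (a 0) _ _))) ⟩
  a 0 * (b 0 * c (suc n) + (tail b ∗ c) n) + (tail a ∗ (b ∗ c)) n ∎

∗-cong-upTo : ∀ {a x y} n → (∀ {i} → i ≤ n → x i ≡ y i) → (a ∗ x) n ≡ (a ∗ y) n
∗-cong-upTo {a} zero    x≡y = cong (a 0 *_) (x≡y z≤n)
∗-cong-upTo {a} (suc n) x≡y =
  cong₂ _+_ (cong (a 0 *_) (x≡y ≤-refl)) (∗-cong-upTo {tail a} n (λ i≤n → x≡y (m≤n⇒m≤1+n i≤n)))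

∗-cong-below : ∀ {a x y n} → a 0 ≡ 0 → (∀ {i} → i < n → x i ≡ y i) → (a ∗ x) n ≡ (a ∗ y) n
∗-cong-below {a} {x} {y} {zero}  a₀≡0 x≡y =
  trans (cong (_* x 0) a₀≡0) (sym (cong (_* y 0) a₀≡0))
∗-cong-below {a} {x} {y} {suc n} a₀≡0 x≡y = cong₂ _+_
  (trans (cong (_* x (suc n)) a₀≡0) (sym (cong (_* y (suc n)) a₀≡0)))
  (∗-cong-upTo {tail a} n (λ i≤n → x≡y (s≤s i≤n)))

fixedPoint-unique : ∀ {A B X Y} → B 0 ≡ 0 → X ≗ A ⊕ B ∗ X → Y ≗ A ⊕ B ∗ Y → X ≗ Y
fixedPoint-unique {A} {B} {X} {Y} B₀≡0 X-fix Y-fix = <-rec (λ n → X n ≡ Y n) step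
  where
  step : ∀ n → (∀ {i} → i < n → X i ≡ Y i) → X n ≡ Y n
  step n below = begin
    X n             ≡⟨ X-fix n ⟩
    A n + (B ∗ X) n ≡⟨ cong (A n +_) (∗-cong-below B₀≡0 below) ⟩
    A n + (B ∗ Y) n ≡⟨ Y-fix n ⟨
    Y n             ∎

fixedPoint-∗ʳ : ∀ {A B G} → G ≗ A ⊕ B ∗ G → ∀ Z → G ∗ Z ≗ A ∗ Z ⊕ B ∗ (G ∗ Z)
fixedPoint-∗ʳ {A} {B} {G} G-fix Z n = begin
  (G ∗ Z) n                       ≡⟨ ∗-congʳ G-fix n ⟩
  ((A ⊕ B ∗ G) ∗ Z) n             ≡⟨ ∗-distribʳ-⊕ A (B ∗ G) Z n ⟩
  (A ∗ Z) n + ((B ∗ G) ∗ Z) n     ≡⟨ cong ((A ∗ Z) n +_) (∗-assoc B G Z n) ⟩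
  (A ∗ Z) n + (B ∗ (G ∗ Z)) n     ∎

-- If G = A/(1 − B) then its invert transform G/(1 − G) is A/(1 − (A + B)).
fixedPoint-invert : ∀ {A B G Y} → G ≗ A ⊕ B ∗ G → Y ≗ G ⊕ G ∗ Y → Y ≗ A ⊕ (A ⊕ B) ∗ Y
fixedPoint-invert {A} {B} {G} {Y} G-fix Y-fix n = begin
  Y n
    ≡⟨ Y-fix n ⟩
  G n + (G ∗ Y) n
    ≡⟨ cong₂ _+_ (G-fix n) (fixedPoint-∗ʳ G-fix Y n) ⟩
  (A n + (B ∗ G) n) + ((A ∗ Y) n + (B ∗ (G ∗ Y)) n)
    ≡⟨ interchange (A n) _ _ _ ⟩
  (A n + (A ∗ Y) n) + ((B ∗ G) n + (B ∗ (G ∗ Y)) n)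
    ≡⟨ cong (A n + (A ∗ Y) n +_) (trans (sym (∗-distribˡ-⊕ B G (G ∗ Y) n)) (∗-congˡ (λ i → sym (Y-fix i)) n)) ⟩
  (A n + (A ∗ Y) n) + (B ∗ Y) n
    ≡⟨ +-assoc (A n) _ _ ⟩
  A n + ((A ∗ Y) n + (B ∗ Y) n)
    ≡⟨ cong (A n +_) (∗-distribʳ-⊕ A B Y n) ⟨
  A n + ((A ⊕ B) ∗ Y) n ∎

pow : Series → ℕ → Series
pow b zero    = 𝟙
pow b (suc k) = b ∗ pow b k

pow-vanishes : ∀ {b} → b 0 ≡ 0 → ∀ {k n} → n < k → pow b k n ≡ 0
pow-vanishes {b} b₀≡0 {suc k} {n} n<1+k = begin
  (b ∗ pow b k) n ≡⟨ ∗-cong-below b₀≡0 (λ i<n → pow-vanishes b₀≡0 (<-≤-trans i<n (s≤s⁻¹ n<1+k))) ⟩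
  (b ∗ 𝟘) n       ≡⟨ ∗-zeroʳ b n ⟩
  0               ∎

sum-applyUpTo-suc : ∀ (g : ℕ → ℕ) K → sum (applyUpTo g (suc K)) ≡ sum (applyUpTo g K) + g K
sum-applyUpTo-suc g K = begin
  sum (applyUpTo g (suc K))           ≡⟨ cong sum (applyUpTo-∷ʳ g K) ⟨
  sum (applyUpTo g K ++ [ g K ])      ≡⟨ sum-++ (applyUpTo g K) [ g K ] ⟩
  sum (applyUpTo g K) + (g K + 0)     ≡⟨ cong (sum (applyUpTo g K) +_) (+-identityʳ (g K)) ⟩
  sum (applyUpTo g K) + g K           ∎

∗-distribˡ-sum : ∀ a (g : ℕ → Series) K →
  a ∗ (λ i → sum (applyUpTo (λ k → g k i) K)) ≗ (λ n → sum (applyUpTo (λ k → (a ∗ g k) n) K))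
∗-distribˡ-sum a g zero    n = ∗-zeroʳ a n
∗-distribˡ-sum a g (suc K) n = trans
  (∗-distribˡ-⊕ a (g 0) (λ i → sum (applyUpTo (λ k → g (suc k) i) K)) n)
  (cong ((a ∗ g 0) n +_) (∗-distribˡ-sum a (λ k → g (suc k)) K n))

powerSum : Series → ℕ → Series
powerSum b K n = sum (applyUpTo (λ k → pow b (suc k) n) K)

-- When b 0 = 0 only the powers bᵏ with k ≤ n reach degree n, so this is Σ_{k≥1} bᵏ.
invert : Series → Series
invert b n = powerSum b n n

powerSum-stable : ∀ {b} → b 0 ≡ 0 → ∀ {n K} → n ≤ K → powerSum b K n ≡ invert b n
powerSum-stable b₀≡0 {K = zero} z≤n = refl
powerSum-stable {b} b₀≡0 {n} {suc K} n≤1+K with m≤n⇒m<n∨m≡n n≤1+K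
... | inj₂ refl     = refl
... | inj₁ n<1+K    = begin
  powerSum b (suc K) n             ≡⟨ sum-applyUpTo-suc (λ k → pow b (suc k) n) K ⟩
  powerSum b K n + pow b (suc K) n ≡⟨ cong₂ _+_ (powerSum-stable b₀≡0 (s≤s⁻¹ n<1+K)) (pow-vanishes b₀≡0 n<1+K) ⟩
  invert b n + 0                   ≡⟨ +-identityʳ _ ⟩
  invert b n                       ∎

invert-fixedPoint : ∀ {b} → b 0 ≡ 0 → invert b ≗ b ⊕ b ∗ invert b
invert-fixedPoint {b} b₀≡0 zero    = sym (cong₂ _+_ b₀≡0 (*-zeroʳ (b 0)))
invert-fixedPoint {b} b₀≡0 (suc n) = begin
  (b ∗ 𝟙) (suc n) + sum (applyUpTo (λ k → (b ∗ pow b (suc k)) (suc n)) n)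
    ≡⟨ cong₂ _+_ (∗-identityʳ b (suc n)) (sym (∗-distribˡ-sum b (λ k → pow b (suc k)) n (suc n))) ⟩
  b (suc n) + (b ∗ powerSum b n) (suc n)
    ≡⟨ cong (b (suc n) +_) (∗-cong-below {b} {powerSum b n} b₀≡0 (λ i<1+n → powerSum-stable b₀≡0 (s≤s⁻¹ i<1+n))) ⟩
  b (suc n) + (b ∗ invert b) (suc n) ∎

sumOver : {A : Set} → (A → ℕ) → List A → ℕ
sumOver F L = sum (map F L)

indicator : Bool → ℕ
indicator b = if b then 1 else 0

sumOver-cong : {A : Set} {F G : A → ℕ} → F ≗ G → ∀ L → sumOver F L ≡ sumOver G L
sumOver-cong F≗G L = cong sum (map-cong F≗G L)

sumOver-+ : {A : Set} (F G : A → ℕ) → ∀ L → sumOver (λ x → F x + G x) L ≡ sumOver F L + sumOver G L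
sumOver-+ F G []      = refl
sumOver-+ F G (x ∷ L) =
  trans (cong (F x + G x +_) (sumOver-+ F G L)) (interchange (F x) (G x) _ _)

sumOver-* : {A : Set} (k : ℕ) (F : A → ℕ) → ∀ L → sumOver (λ x → k * F x) L ≡ k * sumOver F L
sumOver-* k F []      = sym (*-zeroʳ k)
sumOver-* k F (x ∷ L) = trans (cong (k * F x +_) (sumOver-* k F L)) (sym (*-distribˡ-+ k (F x) _))

sumOver-zero : {A : Set} {F : A → ℕ} → (∀ x → F x ≡ 0) → ∀ L → sumOver F L ≡ 0
sumOver-zero F≡0 []      = refl
sumOver-zero F≡0 (x ∷ L) = cong₂ _+_ (F≡0 x) (sumOver-zero F≡0 L)

sumOver-++ : {A : Set} (F : A → ℕ) → ∀ L M → sumOver F (L ++ M) ≡ sumOver F L + sumOver F M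
sumOver-++ F L M = trans (cong sum (map-++ F L M)) (sum-++ (map F L) (map F M))

sumOver-concatMap : {A B : Set} (F : B → ℕ) (g : A → List B) → ∀ L →
  sumOver F (concatMap g L) ≡ sumOver (λ x → sumOver F (g x)) L
sumOver-concatMap F g []      = refl
sumOver-concatMap F g (x ∷ L) =
  trans (sumOver-++ F (g x) _) (cong (sumOver F (g x) +_) (sumOver-concatMap F g L))

sumOver-map : {A B : Set} (F : B → ℕ) (g : A → B) → ∀ L → sumOver F (map g L) ≡ sumOver (λ x → F (g x)) L
sumOver-map F g L = cong sum (sym (map-∘ L))

sumOver-filter : {A : Set} (F : A → ℕ) (P : A → Bool) → ∀ L →
  sumOver F (filter (λ x → T? (P x)) L) ≡ sumOver (λ x → if P x then F x else 0) L
sumOver-filter F P []      = refl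
sumOver-filter F P (x ∷ L) with P x
... | true  = cong (F x +_) (sumOver-filter F P L)
... | false = sumOver-filter F P L

length-sumOver : {A : Set} (L : List A) → length L ≡ sumOver (λ _ → 1) L
length-sumOver []      = refl
length-sumOver (x ∷ L) = cong suc (length-sumOver L)

length-filter : {A : Set} (P : A → Bool) → ∀ L →
  length (filter (λ x → T? (P x)) L) ≡ sumOver (λ x → indicator (P x)) L
length-filter P L = trans (length-sumOver (filter (λ x → T? (P x)) L)) (sumOver-filter (λ _ → 1) P L)

sumOver-applyUpTo-const : ∀ {F : ℕ → ℕ} {X} n f → (∀ {i} → i < n → F (f i) ≡ X) →
  sumOver F (applyUpTo f n) ≡ n * X
sumOver-applyUpTo-const zero    f F≡X = refl
sumOver-applyUpTo-const (suc n) f F≡X =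
  cong₂ _+_ (F≡X (s≤s z≤n)) (sumOver-applyUpTo-const n (λ i → f (suc i)) (λ i<n → F≡X (s≤s i<n)))

sumOver-upTo-const : ∀ {F : ℕ → ℕ} {X} n → (∀ {i} → i < n → F i ≡ X) → sumOver F (upTo n) ≡ n * X
sumOver-upTo-const n = sumOver-applyUpTo-const n (λ i → i)

-- Walks and Dyck paths weighted by their number of hills

weightedWalks : (ℕ → ℕ) → ℕ → ℕ → ℕ
weightedWalks ω l h = sumOver (λ w → if validFrom h w then ω (hillsFrom h w) else 0) (allWords l)

sumOver-allWords-suc : (F : List Step → ℕ) → ∀ l →
  sumOver F (allWords (suc l)) ≡ sumOver (λ w → F (U ∷ w) + F (D ∷ w)) (allWords l)
sumOver-allWords-suc F l = trans
  (sumOver-concatMap F (λ w → (U ∷ w) ∷ (D ∷ w) ∷ []) (allWords l))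
  (sumOver-cong (λ w → cong (F (U ∷ w) +_) (+-identityʳ (F (D ∷ w)))) (allWords l))

weightedWalks-cong : ∀ {ω ω′} → ω ≗ ω′ → ∀ l h → weightedWalks ω l h ≡ weightedWalks ω′ l h
weightedWalks-cong ω≗ω′ l h =
  sumOver-cong (λ w → cong (λ x → if validFrom h w then x else 0) (ω≗ω′ (hillsFrom h w))) (allWords l)

weightedWalks-linear : ∀ k ω ν l h →
  weightedWalks (λ x → k * ω x + ν x) l h ≡ k * weightedWalks ω l h + weightedWalks ν l h
weightedWalks-linear k ω ν l h = begin
  weightedWalks (λ x → k * ω x + ν x) l h
    ≡⟨ sumOver-cong (λ w → if-linear (validFrom h w) (ω (hillsFrom h w)) (ν (hillsFrom h w))) (allWords l) ⟩
  sumOver (λ w → k * walk ω w + walk ν w) (allWords l)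
    ≡⟨ sumOver-+ (λ w → k * walk ω w) (walk ν) (allWords l) ⟩
  sumOver (λ w → k * walk ω w) (allWords l) + weightedWalks ν l h
    ≡⟨ cong (_+ weightedWalks ν l h) (sumOver-* k (walk ω) (allWords l)) ⟩
  k * weightedWalks ω l h + weightedWalks ν l h ∎
  where
  walk : (ℕ → ℕ) → List Step → ℕ
  walk ω w = if validFrom h w then ω (hillsFrom h w) else 0
  if-linear : ∀ b x y → (if b then k * x + y else 0) ≡ k * (if b then x else 0) + (if b then y else 0)
  if-linear true  x y = refl
  if-linear false x y = sym (cong (_+ 0) (*-zeroʳ k))

weightedWalks-zero : ∀ l h → weightedWalks (λ _ → 0) l h ≡ 0
weightedWalks-zero l h = sumOver-zero (λ w → if-zero (validFrom h w)) (allWords l)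
  where
  if-zero : ∀ b → (if b then 0 else 0) ≡ 0
  if-zero true  = refl
  if-zero false = refl

weightedWalks-empty : ∀ ω → weightedWalks ω 0 0 ≡ ω 0
weightedWalks-empty ω = +-identityʳ (ω 0)

weightedWalks-aboveGround : ∀ ω l h →
  weightedWalks ω (suc l) (suc h) ≡ weightedWalks ω l (suc (suc h)) + weightedWalks ω l h
weightedWalks-aboveGround ω l h = trans (sumOver-allWords-suc _ l) (sumOver-+ _ _ (allWords l))

-- From height 0 a walk either starts with a hill or climbs to height 2.
weightedWalks-ground : ∀ ω l →
  weightedWalks ω (suc (suc l)) 0 ≡ weightedWalks (λ x → ω (suc x)) l 0 + weightedWalks ω l 2
weightedWalks-ground ω l = begin
  weightedWalks ω (suc (suc l)) 0
    ≡⟨ sumOver-allWords-suc _ (suc l) ⟩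
  _ ≡⟨ sumOver-allWords-suc _ l ⟩
  sumOver (λ v → (fromTwo v + 0) + (hillFirst v + 0)) (allWords l)
    ≡⟨ sumOver-cong (λ v → trans (cong₂ _+_ (+-identityʳ (fromTwo v)) (+-identityʳ (hillFirst v)))
         (+-comm (fromTwo v) (hillFirst v))) (allWords l) ⟩
  sumOver (λ v → hillFirst v + fromTwo v) (allWords l)
    ≡⟨ sumOver-+ hillFirst fromTwo (allWords l) ⟩
  weightedWalks (λ x → ω (suc x)) l 0 + weightedWalks ω l 2 ∎
  where
  fromTwo hillFirst : List Step → ℕ
  fromTwo   v = if validFrom 2 v then ω (hillsFrom 2 v) else 0
  hillFirst v = if validFrom 0 v then ω (suc (hillsFrom 0 v)) else 0

-- Walks of length i from height h that reach height 0 for the first time at their end.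
firstPassage : ℕ → ℕ → ℕ
firstPassage zero    zero    = 1
firstPassage zero    (suc h) = 0
firstPassage (suc i) zero    = 0
firstPassage (suc i) (suc h) = firstPassage i (suc (suc h)) + firstPassage i h

firstPassage-fromGround : (λ i → firstPassage i 0) ≗ 𝟙
firstPassage-fromGround zero    = refl
firstPassage-fromGround (suc i) = refl

-- No hill can occur before the walk first reaches height 0.
weightedWalks-firstPassage : ∀ ω l h →
  weightedWalks ω l h ≡ ((λ i → firstPassage i h) ∗ (λ l → weightedWalks ω l 0)) l
weightedWalks-firstPassage ω l zero =
  sym (trans (∗-congʳ firstPassage-fromGround l) (∗-identityˡ _ l))
weightedWalks-firstPassage ω zero    (suc h) = refl
weightedWalks-firstPassage ω (suc l) (suc h) = begin
  weightedWalks ω (suc l) (suc h)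
    ≡⟨ weightedWalks-aboveGround ω l h ⟩
  weightedWalks ω l (suc (suc h)) + weightedWalks ω l h
    ≡⟨ cong₂ _+_ (weightedWalks-firstPassage ω l (suc (suc h))) (weightedWalks-firstPassage ω l h) ⟩
  (passage (suc (suc h)) ∗ ground) l + (passage h ∗ ground) l
    ≡⟨ ∗-distribʳ-⊕ (passage (suc (suc h))) (passage h) ground l ⟨
  (tail (passage (suc h)) ∗ ground) l ∎
  where
  passage : ℕ → Series
  passage h i = firstPassage i h
  ground : Series
  ground l = weightedWalks ω l 0

IsEven : ℕ → Set
IsEven zero          = ⊤
IsEven (suc zero)    = ⊥
IsEven (suc (suc n)) = IsEven n

IsEven-double : ∀ i → IsEven (i + i)
IsEven-double zero    = _
IsEven-double (suc i) = subst (λ t → IsEven (suc t)) (sym (+-suc i i)) (IsEven-double i)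

firstPassage-odd : ∀ i h → IsEven (suc (i + h)) → firstPassage i h ≡ 0
firstPassage-odd zero    zero    ()
firstPassage-odd zero    (suc h) _ = refl
firstPassage-odd (suc i) zero    _ = refl
firstPassage-odd (suc i) (suc h) even = cong₂ _+_
  (firstPassage-odd i (suc (suc h)) (subst (λ t → IsEven (suc t)) (sym (+-suc i (suc h))) even))
  (firstPassage-odd i h (subst IsEven (+-suc i h) even))

evenPart : Series → Series
evenPart a j = a (j + j)

∗-evenPart : ∀ a b → (∀ i → a (suc (i + i)) ≡ 0) → ∀ r → (a ∗ b) (r + r) ≡ (evenPart a ∗ evenPart b) r
∗-evenPart a b a-odd zero    = refl
∗-evenPart a b a-odd (suc r) = begin
  (a ∗ b) (suc r + suc r)
    ≡⟨ cong (a ∗ b) (cong suc (+-suc r r)) ⟩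
  a 0 * b (suc (suc (r + r))) + (a 1 * b (suc (r + r)) + (tail (tail a) ∗ b) (r + r))
    ≡⟨ cong (λ t → a 0 * b (suc (suc (r + r))) + (t * b (suc (r + r)) + (tail (tail a) ∗ b) (r + r))) (a-odd 0) ⟩
  a 0 * b (suc (suc (r + r))) + (tail (tail a) ∗ b) (r + r)
    ≡⟨ cong₂ _+_ (sym (cong (λ t → a 0 * b (suc t)) (+-suc r r))) (∗-evenPart (tail (tail a)) b tail²-odd r) ⟩
  a 0 * b (suc r + suc r) + (evenPart (tail (tail a)) ∗ evenPart b) r
    ≡⟨ cong (a 0 * b (suc r + suc r) +_) (∗-congʳ (λ j → sym (cong (λ t → a (suc t)) (+-suc j j))) r) ⟩
  (evenPart a ∗ evenPart b) (suc r) ∎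
  where
  tail²-odd : ∀ i → tail (tail a) (suc (i + i)) ≡ 0
  tail²-odd i = trans (sym (cong (λ t → a (suc (suc t))) (+-suc i i))) (a-odd (suc i))

dyckSum : (ℕ → ℕ) → Series
dyckSum ω = evenPart (λ l → weightedWalks ω l 0)

-- Coefficient n counts the Dyck paths U w D of semilength n with w nonempty.
nonHillPrimes : Series
nonHillPrimes = shift (evenPart (λ i → firstPassage i 2))

dyckSum-recursion : ∀ ω →
  dyckSum ω ≗ ω 0 · 𝟙 ⊕ shift (dyckSum (λ x → ω (suc x))) ⊕ nonHillPrimes ∗ dyckSum ω
dyckSum-recursion ω zero =
  trans (weightedWalks-empty ω) (sym (trans (+-identityʳ _) (trans (+-identityʳ _) (*-identityʳ (ω 0)))))
dyckSum-recursion ω (suc r) = begin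
  weightedWalks ω (suc r + suc r) 0
    ≡⟨ cong (λ l → weightedWalks ω l 0) (cong suc (+-suc r r)) ⟩
  weightedWalks ω (suc (suc (r + r))) 0
    ≡⟨ weightedWalks-ground ω (r + r) ⟩
  dyckSum ωₛ r + weightedWalks ω (r + r) 2
    ≡⟨ cong (dyckSum ωₛ r +_) (weightedWalks-firstPassage ω (r + r) 2) ⟩
  dyckSum ωₛ r + ((λ i → firstPassage i 2) ∗ (λ l → weightedWalks ω l 0)) (r + r)
    ≡⟨ cong (dyckSum ωₛ r +_) (∗-evenPart _ _ fromTwo-odd r) ⟩
  dyckSum ωₛ r + (evenPart (λ i → firstPassage i 2) ∗ dyckSum ω) r
    ≡⟨ cong (λ t → t + dyckSum ωₛ r + (evenPart (λ i → firstPassage i 2) ∗ dyckSum ω) r) (*-zeroʳ (ω 0)) ⟨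
  ω 0 * 0 + dyckSum ωₛ r + (evenPart (λ i → firstPassage i 2) ∗ dyckSum ω) r ∎
  where
  ωₛ : ℕ → ℕ
  ωₛ x = ω (suc x)
  fromTwo-odd : ∀ i → firstPassage (suc (i + i)) 2 ≡ 0
  fromTwo-odd i = firstPassage-odd (suc (i + i)) 2 (subst IsEven (+-comm 2 (i + i)) (IsEven-double i))

noHills : ℕ → ℕ
noHills h = indicator (h ≡ᵇ 0)

hillSeries : (ℕ → ℕ) → Series
hillSeries ω = shift (dyckSum ω)

fineSeries : Series
fineSeries = hillSeries noHills

hillSeries-cong : ∀ {ω ω′} → ω ≗ ω′ → hillSeries ω ≗ hillSeries ω′
hillSeries-cong ω≗ω′ zero    = refl
hillSeries-cong ω≗ω′ (suc r) = weightedWalks-cong ω≗ω′ (r + r) 0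

hillSeries-linear : ∀ k ω ν → hillSeries (λ x → k * ω x + ν x) ≗ k · hillSeries ω ⊕ hillSeries ν
hillSeries-linear k ω ν zero    = sym (cong (_+ 0) (*-zeroʳ k))
hillSeries-linear k ω ν (suc r) = weightedWalks-linear k ω ν (r + r) 0

hillSeries-zero : hillSeries (λ _ → 0) ≗ 𝟘
hillSeries-zero zero    = refl
hillSeries-zero (suc r) = weightedWalks-zero (r + r) 0

noHills-recursion : dyckSum noHills ≗ 𝟙 ⊕ nonHillPrimes ∗ dyckSum noHills
noHills-recursion n = trans (dyckSum-recursion noHills n)
  (cong (_+ (nonHillPrimes ∗ dyckSum noHills) n)
    (trans (cong₂ _+_ (*-identityˡ (𝟙 n)) (hillSeries-zero n)) (+-identityʳ (𝟙 n))))

dyckSum-factor : ∀ ω → dyckSum ω ≗ dyckSum noHills ∗ (ω 0 · 𝟙 ⊕ shift (dyckSum (λ x → ω (suc x))))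
dyckSum-factor ω = fixedPoint-unique refl (dyckSum-recursion ω) factor-fix
  where
  A : Series
  A = ω 0 · 𝟙 ⊕ shift (dyckSum (λ x → ω (suc x)))
  factor-fix : dyckSum noHills ∗ A ≗ A ⊕ nonHillPrimes ∗ (dyckSum noHills ∗ A)
  factor-fix n = trans (fixedPoint-∗ʳ noHills-recursion A n)
    (cong (_+ (nonHillPrimes ∗ (dyckSum noHills ∗ A)) n) (∗-identityˡ A n))

hillSeries-decompose : ∀ ω → hillSeries ω ≗ ω 0 · fineSeries ⊕ fineSeries ∗ hillSeries (λ x → ω (suc x))
hillSeries-decompose ω zero    = sym (trans (+-identityʳ _) (*-zeroʳ (ω 0)))
hillSeries-decompose ω (suc r) = begin
  dyckSum ω r
    ≡⟨ dyckSum-factor ω r ⟩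
  (e₀ ∗ (ω 0 · 𝟙 ⊕ shift Dₛ)) r
    ≡⟨ ∗-distribˡ-⊕ e₀ (ω 0 · 𝟙) (shift Dₛ) r ⟩
  (e₀ ∗ (ω 0 · 𝟙)) r + (e₀ ∗ shift Dₛ) r
    ≡⟨ cong (_+ (e₀ ∗ shift Dₛ) r) (trans (∗-scaleʳ (ω 0) e₀ 𝟙 r) (cong (ω 0 *_) (∗-identityʳ e₀ r))) ⟩
  ω 0 * e₀ r + (e₀ ∗ shift Dₛ) r ∎
  where
  e₀ Dₛ : Series
  e₀ = dyckSum noHills
  Dₛ = dyckSum (λ x → ω (suc x))

hillSeries-recurrence : ∀ {ω ν} k → (∀ h → ω (suc h) ≡ k * ω h + ν h) →
  hillSeries ω ≗ ω 0 · fineSeries ⊕ fineSeries ∗ hillSeries ν ⊕ (k · fineSeries) ∗ hillSeries ω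
hillSeries-recurrence {ω} {ν} k ω-suc n = begin
  hillSeries ω n
    ≡⟨ hillSeries-decompose ω n ⟩
  ω 0 * F n + (F ∗ hillSeries (λ x → ω (suc x))) n
    ≡⟨ cong (ω 0 * F n +_) (∗-congˡ (λ i → trans (hillSeries-cong ω-suc i) (hillSeries-linear k ω ν i)) n) ⟩
  ω 0 * F n + (F ∗ (k · H ⊕ hillSeries ν)) n
    ≡⟨ cong (ω 0 * F n +_) (∗-distribˡ-⊕ F (k · H) (hillSeries ν) n) ⟩
  ω 0 * F n + ((F ∗ (k · H)) n + (F ∗ hillSeries ν) n)
    ≡⟨ cong (λ t → ω 0 * F n + (t + (F ∗ hillSeries ν) n)) (trans (∗-scaleʳ k F H n) (sym (∗-scaleˡ k F H n))) ⟩
  ω 0 * F n + (((k · F) ∗ H) n + (F ∗ hillSeries ν) n)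
    ≡⟨ x∙yz≈xz∙y (ω 0 * F n) _ _ ⟩
  ω 0 * F n + (F ∗ hillSeries ν) n + ((k · F) ∗ H) n ∎
  where
  F H : Series
  F = fineSeries
  H = hillSeries ω

hillSeries-geometric : ∀ {ω} k → ω 0 ≡ 1 → (∀ h → ω (suc h) ≡ k * ω h) →
  hillSeries ω ≗ fineSeries ⊕ (k · fineSeries) ∗ hillSeries ω
hillSeries-geometric {ω} k ω₀≡1 ω-suc n = begin
  hillSeries ω n
    ≡⟨ hillSeries-recurrence k (λ h → trans (ω-suc h) (sym (+-identityʳ _))) n ⟩
  ω 0 * F n + (F ∗ hillSeries (λ _ → 0)) n + rest
    ≡⟨ cong (_+ rest) (cong₂ _+_ (trans (cong (_* F n) ω₀≡1) (*-identityˡ (F n)))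
         (trans (∗-congˡ hillSeries-zero n) (∗-zeroʳ F n))) ⟩
  F n + 0 + rest
    ≡⟨ cong (_+ rest) (+-identityʳ (F n)) ⟩
  F n + rest ∎
  where
  F : Series
  F = fineSeries
  rest : ℕ
  rest = ((k · F) ∗ hillSeries ω) n

sumOver-dyckPaths : ∀ ω r → sumOver (λ p → ω (hills p)) (dyckPaths r) ≡ dyckSum ω r
sumOver-dyckPaths ω r = sumOver-filter _ isDyck (allWords (r + r))

-- Colourings of hills

numColorings : ℕ → ℕ → ℕ
numColorings M h = length (colorings M h)

numColorings-suc : ∀ M h → numColorings M (suc h) ≡ M * numColorings M h
numColorings-suc M h = begin
  length (colorings M (suc h))
    ≡⟨ length-sumOver (colorings M (suc h)) ⟩
  sumOver (λ _ → 1) (concatMap (λ c → map (suc c ∷_) (colorings M h)) (upTo M))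
    ≡⟨ sumOver-concatMap (λ _ → 1) (λ c → map (suc c ∷_) (colorings M h)) (upTo M) ⟩
  sumOver (λ c → sumOver (λ _ → 1) (map (suc c ∷_) (colorings M h))) (upTo M)
    ≡⟨ sumOver-upTo-const M (λ {c} _ →
         trans (sumOver-map (λ _ → 1) (suc c ∷_) (colorings M h)) (sym (length-sumOver (colorings M h)))) ⟩
  M * numColorings M h ∎

coloringsWith : ℕ → ℕ → ℕ → ℕ
coloringsWith M j h = length (filter (λ c → T? (countOf M c ≡ᵇ j)) (colorings M h))

coloringsWith⁻ : ℕ → ℕ → ℕ → ℕ
coloringsWith⁻ M zero    h = 0
coloringsWith⁻ M (suc j) h = coloringsWith M j h

≡ᵇ-refl : ∀ n → (n ≡ᵇ n) ≡ true
≡ᵇ-refl zero    = refl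
≡ᵇ-refl (suc n) = ≡ᵇ-refl n

<⇒≢ᵇ : ∀ {c m} → c < m → (m ≡ᵇ c) ≡ false
<⇒≢ᵇ {zero}  {suc m} _         = refl
<⇒≢ᵇ {suc c} {suc m} (s≤s c<m) = <⇒≢ᵇ c<m

-- The first hill gets one of the colours 1, …, m, which are not counted, or the counted colour m + 1.
coloringsWith-suc : ∀ m j h →
  coloringsWith (suc m) j (suc h) ≡ m * coloringsWith (suc m) j h + coloringsWith⁻ (suc m) j h
coloringsWith-suc m j h = begin
  coloringsWith M j (suc h)
    ≡⟨ length-filter (λ c → countOf M c ≡ᵇ j) (colorings M (suc h)) ⟩
  sumOver χ (concatMap (λ c → map (suc c ∷_) (colorings M h)) (upTo M))
    ≡⟨ sumOver-concatMap χ (λ c → map (suc c ∷_) (colorings M h)) (upTo M) ⟩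
  sumOver (λ c → sumOver χ (map (suc c ∷_) (colorings M h))) (upTo M)
    ≡⟨ sumOver-cong (λ c → sumOver-map χ (suc c ∷_) (colorings M h)) (upTo M) ⟩
  sumOver withFirst (upTo M)
    ≡⟨ cong (sumOver withFirst) (upTo-∷ʳ m) ⟨
  sumOver withFirst (upTo m ++ [ m ])
    ≡⟨ sumOver-++ withFirst (upTo m) [ m ] ⟩
  sumOver withFirst (upTo m) + (withFirst m + 0)
    ≡⟨ cong₂ _+_ (sumOver-upTo-const m ordinaryColour) (trans (+-identityʳ _) lastColour) ⟩
  m * sumOver χ (colorings M h) + coloringsWith⁻ M j h
    ≡⟨ cong (λ t → m * t + coloringsWith⁻ M j h) (length-filter (λ c → countOf M c ≡ᵇ j) (colorings M h)) ⟨
  m * coloringsWith M j h + coloringsWith⁻ M j h ∎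
  where
  M : ℕ
  M = suc m
  χ : List ℕ → ℕ
  χ c = indicator (countOf M c ≡ᵇ j)
  withFirst : ℕ → ℕ
  withFirst c = sumOver (λ rest → χ (suc c ∷ rest)) (colorings M h)
  withFirst-≡ᵇ : ∀ {c b} → (m ≡ᵇ c) ≡ b →
    withFirst c ≡ sumOver (λ rest → indicator ((indicator b + countOf M rest) ≡ᵇ j)) (colorings M h)
  withFirst-≡ᵇ m≡ᵇc = sumOver-cong
    (λ rest → cong (λ b → indicator ((indicator b + countOf M rest) ≡ᵇ j)) m≡ᵇc) (colorings M h)
  ordinaryColour : ∀ {c} → c < m → withFirst c ≡ sumOver χ (colorings M h)
  ordinaryColour c<m = withFirst-≡ᵇ (<⇒≢ᵇ c<m)
  oneMore : ∀ i → sumOver (λ rest → indicator (suc (countOf M rest) ≡ᵇ i)) (colorings M h)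
    ≡ coloringsWith⁻ M i h
  oneMore zero    = sumOver-zero (λ _ → refl) (colorings M h)
  oneMore (suc i) = sym (length-filter (λ c → countOf M c ≡ᵇ i) (colorings M h))
  lastColour : withFirst m ≡ coloringsWith⁻ M j h
  lastColour = trans (withFirst-≡ᵇ (≡ᵇ-refl m)) (oneMore j)

-- f m and Fine are only meaningful from index 1 on; gf discards their value at 0.
gf : (ℕ → ℕ) → Series
gf a zero    = 0
gf a (suc n) = a (suc n)

gf-Fine : gf Fine ≗ fineSeries
gf-Fine zero    = refl
gf-Fine (suc r) = trans (length-filter (λ w → hills w ≡ᵇ 0) (dyckPaths r)) (sumOver-dyckPaths noHills r)

∗-as-sum : ∀ a b n → (a ∗ b) n ≡ sum (applyUpTo (λ j → a j * b (n ∸ j)) (suc n))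
∗-as-sum a b zero    = sym (+-identityʳ (a 0 * b 0))
∗-as-sum a b (suc n) = cong (a 0 * b (suc n) +_) (∗-as-sum (tail a) b n)

invertTerm-pow : ∀ a k n → invertTerm a n k ≡ pow (gf a) k n
invertTerm-pow a zero    zero    = refl
invertTerm-pow a zero    (suc n) = refl
invertTerm-pow a (suc k) zero    = refl
invertTerm-pow a (suc k) (suc n) = begin
  sumOver π (concatMap (λ j → map (suc j ∷_) (compositions (n ∸ j) k)) (upTo (suc n)))
    ≡⟨ sumOver-concatMap π (λ j → map (suc j ∷_) (compositions (n ∸ j) k)) (upTo (suc n)) ⟩
  sumOver (λ j → sumOver π (map (suc j ∷_) (compositions (n ∸ j) k))) (upTo (suc n))
    ≡⟨ sumOver-cong firstPart (upTo (suc n)) ⟩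
  sumOver (λ j → a (suc j) * pow (gf a) k (n ∸ j)) (upTo (suc n))
    ≡⟨ cong sum (map-upTo (λ j → a (suc j) * pow (gf a) k (n ∸ j)) (suc n)) ⟩
  sum (applyUpTo (λ j → a (suc j) * pow (gf a) k (n ∸ j)) (suc n))
    ≡⟨ ∗-as-sum (tail (gf a)) (pow (gf a) k) n ⟨
  (tail (gf a) ∗ pow (gf a) k) n ∎
  where
  π : List ℕ → ℕ
  π c = product (map a c)
  firstPart : ∀ j → sumOver π (map (suc j ∷_) (compositions (n ∸ j) k)) ≡ a (suc j) * pow (gf a) k (n ∸ j)
  firstPart j = begin
    sumOver π (map (suc j ∷_) (compositions (n ∸ j) k))
      ≡⟨ sumOver-map π (suc j ∷_) (compositions (n ∸ j) k) ⟩
    sumOver (λ c → a (suc j) * π c) (compositions (n ∸ j) k)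
      ≡⟨ sumOver-* (a (suc j)) π (compositions (n ∸ j) k) ⟩
    a (suc j) * invertTerm a (n ∸ j) k
      ≡⟨ cong (a (suc j) *_) (invertTerm-pow a k (n ∸ j)) ⟩
    a (suc j) * pow (gf a) k (n ∸ j) ∎

gf-f-suc-invert : ∀ m → gf (f (suc m)) ≗ invert (gf (f m))
gf-f-suc-invert m zero    = refl
gf-f-suc-invert m (suc n) = cong sum (trans
  (map-cong (λ j → invertTerm-pow (f m) (suc j) (suc n)) (upTo (suc n)))
  (map-upTo (λ j → pow (gf (f m)) (suc j) (suc n)) (suc n)))

gf-f-suc : ∀ m → gf (f (suc m)) ≗ gf (f m) ⊕ gf (f m) ∗ gf (f (suc m))
gf-f-suc m n = begin
  gf (f (suc m)) n                ≡⟨ gf-f-suc-invert m n ⟩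
  invert G n                      ≡⟨ invert-fixedPoint refl n ⟩
  G n + (G ∗ invert G) n          ≡⟨ cong (G n +_) (∗-congˡ (λ i → sym (gf-f-suc-invert m i)) n) ⟩
  G n + (G ∗ gf (f (suc m))) n    ∎
  where
  G : Series
  G = gf (f m)

gf-f-fixedPoint : ∀ m → gf (f m) ≗ fineSeries ⊕ (m · fineSeries) ∗ gf (f m)
gf-f-fixedPoint zero    n = trans (gf-Fine n)
  (sym (trans (cong (fineSeries n +_) (∗-scaleˡ 0 fineSeries (gf Fine) n)) (+-identityʳ _)))
gf-f-fixedPoint (suc m) = fixedPoint-invert (gf-f-fixedPoint m) (gf-f-suc m)

gf-f-colored : ∀ m → gf (f m) ≗ hillSeries (numColorings m)
gf-f-colored m = fixedPoint-unique (*-zeroʳ m) (gf-f-fixedPoint m)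
  (hillSeries-geometric m refl (numColorings-suc m))

pow-gf-f : ∀ m j → pow (gf (f m)) (suc j) ≗ hillSeries (coloringsWith (suc m) j)
pow-gf-f m zero = fixedPoint-unique (*-zeroʳ m) pow-fix
  (hillSeries-geometric m refl (λ h → trans (coloringsWith-suc m 0 h) (+-identityʳ _)))
  where
  G : Series
  G = gf (f m)
  pow-fix : pow G 1 ≗ fineSeries ⊕ (m · fineSeries) ∗ pow G 1
  pow-fix n = trans (∗-identityʳ G n) (trans (gf-f-fixedPoint m n)
    (cong (fineSeries n +_) (∗-congˡ (λ i → sym (∗-identityʳ G i)) n)))
pow-gf-f m (suc j) = fixedPoint-unique (*-zeroʳ m) pow-fix
  (hillSeries-recurrence m (coloringsWith-suc m (suc j)))
  where
  G : Series
  G = gf (f m)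
  pow-fix : pow G (suc (suc j)) ≗
    0 · fineSeries ⊕ fineSeries ∗ hillSeries (coloringsWith (suc m) j) ⊕ (m · fineSeries) ∗ pow G (suc (suc j))
  pow-fix n = trans (fixedPoint-∗ʳ (gf-f-fixedPoint m) (pow G (suc j)) n)
    (cong (_+ ((m · fineSeries) ∗ pow G (suc (suc j))) n) (∗-congˡ (pow-gf-f m j) n))

mainTheorem1 : (m : ℕ) → 1 ≤ m →
    ((n k : ℕ) → 1 ≤ k → k ≤ n → g m n k ≡ coloredDyckWith m (n ∸ 1) (k ∸ 1))
    × ((n : ℕ) → 1 ≤ n → f m n ≡ coloredDyck m (n ∸ 1))
mainTheorem1 (suc m) _ = part1 , part2
  where
  part1 : (n k : ℕ) → 1 ≤ k → k ≤ n → g (suc m) n k ≡ coloredDyckWith (suc m) (n ∸ 1) (k ∸ 1)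
  part1 (suc r) (suc j) _ _ = begin
    invertTerm (f m) (suc r) (suc j)              ≡⟨ invertTerm-pow (f m) (suc j) (suc r) ⟩
    pow (gf (f m)) (suc j) (suc r)                ≡⟨ pow-gf-f m j (suc r) ⟩
    dyckSum (coloringsWith (suc m) j) r           ≡⟨ sumOver-dyckPaths (coloringsWith (suc m) j) r ⟨
    coloredDyckWith (suc m) r j                   ∎
  part2 : (n : ℕ) → 1 ≤ n → f (suc m) n ≡ coloredDyck (suc m) (n ∸ 1)
  part2 (suc r) _ = trans (gf-f-colored (suc m) (suc r)) (sym (sumOver-dyckPaths (numColorings (suc m)) r))
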